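{- Let $a, b$ be integers satisfying $a \geq 0$, $b \geq 1$. Then for any positive integer $n$, $$H_n^*[\{2\}^a] = \sum_{k=1}^n \frac{1 + q^k}{[k]_q^{2a}} \frac{\begin{bmatrix} n \\ k \end{bmatrix}}{\begin{bmatrix} n+k \\ k \end{bmatrix}} (-1)^{k-1} q^{k(k-1)/2+ak},$$ $$H_n^*[\{2\}^a, 1] = \sum_{k=1}^n \frac{1 + q^k}{[k]_q^{2a+1}} \frac{\begin{bmatrix} n \\ k \end{bmatrix}}{\begin{bmatrix} n+k \\ k \end{bmatrix}} q^{k^2+ak},$$ $$H_n^*[\{2\}^a, 1, \{2\}^b] = - \sum_{k=1}^n \frac{1+q^k}{[k]_q^{2(a+b)+1}} \frac{\begin{bmatrix} n \\ k \end{bmatrix}}{\begin{bmatrix} n+k \\ k \end{bmatrix}} (-1)^k q^{k(k+1)/2+(a+b)k} - \sum_{k=1}^n \frac{1+q^k}{[k]_q^{2a+1}} \frac{\begin{bmatrix} n \\ k \end{bmatrix}}{\begin{bmatrix} n+k \\ k \end{bmatrix}} q^{k^2+ak} \sum_{j=1}^{k-1} \frac{(-1)^j (1+q^j) q^{bj-j(j+1)/2}}{[j]_q^{2b}}.$$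
   Context: Let $0<q<1$, $[n]_q = \frac{1-q^n}{1-q}$, $(q)_n=\prod_{k=0}^{n-1}(1-q^{k+1})$, and the Gaussian $q$-binomial coefficient $\begin{bmatrix} n \\ m \end{bmatrix} = \frac{(q)_n}{(q)_m (q)_{n-m}}$ for $0\le m\le n$, $0$ otherwise. For non-negative integer $n$ and $\mathbf{s}=(s_1,\dots,s_m)\in\mathbb{Z}^m$, the $q$-multiple harmonic star sum is $H_n^*[s_1,\dots,s_m] = \sum_{n \geq k_1 \geq \dots \geq k_m \geq 1} \prod_{j=1}^m \frac{q^{k_j}}{[k_j]_q^{s_j}}$, with $H_n^*[\emptyset]=1$. Here $\{2\}^a$ denotes the string $2,\dots,2$ ($a$ times).
   Formalization: The parameter q is rational, with $0<q<1$, rather than real. -}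

module Defs where

open import Data.Nat as ℕ using (ℕ; zero; suc; _∸_; _≤?_)
open import Data.Nat.DivMod using (_/_)
open import Data.Integer as ℤ using (ℤ; +_; -[1+_])
open import Data.Rational using (ℚ; 0ℚ; 1ℚ; _+_; _*_; _-_; -_; 1/_; ≢-nonZero)
open import Data.Rational.Properties using (_≟_)
open import Data.List using (List; []; _∷_)
open import Relation.Nullary using (yes; no)

-- Total reciprocal on ℚ (value 0 at 0; never used at 0 in the theorem
-- since all denominators are non-zero for 0 < q < 1).
inv : ℚ → ℚ
inv p with p ≟ 0ℚ
... | yes _  = 0ℚ
... | no p≢0 = 1/_ p {{≢-nonZero p≢0}}

_^_ : ℚ → ℕ → ℚ
x ^ zero  = 1ℚ
x ^ suc n = x * (x ^ n)

_^ᶻ_ : ℚ → ℤ → ℚ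
x ^ᶻ (+ n)      = x ^ n
x ^ᶻ -[1+ n ]   = inv (x ^ suc n)

Σ[1‥_] : ℕ → (ℕ → ℚ) → ℚ
Σ[1‥ zero ] f  = 0ℚ
Σ[1‥ suc n ] f = Σ[1‥ n ] f + f (suc n)

[_]_ : ℕ → ℚ → ℚ
[ n ] q = (1ℚ - q ^ n) * inv (1ℚ - q)

poch : ℚ → ℕ → ℚ
poch q zero    = 1ℚ
poch q (suc n) = poch q n * (1ℚ - q ^ suc n)

qbinom : ℚ → ℕ → ℕ → ℚ
qbinom q n m with m ≤? n
... | yes _ = poch q n * inv (poch q m * poch q (n ∸ m))
... | no _  = 0ℚ

-- q-multiple harmonic star sum
-- H*_n[s₁,…,s_m] = Σ_{n ≥ k₁ ≥ … ≥ k_m ≥ 1} ∏_j q^{k_j} / [k_j]_q^{s_j}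
Hstar : ℚ → ℕ → List ℤ → ℚ
Hstar q n []       = 1ℚ
Hstar q n (s ∷ ss) = Σ[1‥ n ] (λ k → q ^ k * inv (([ k ] q) ^ᶻ s) * Hstar q k ss)

sgn : ℕ → ℚ
sgn zero    = 1ℚ
sgn (suc n) = - sgn n

ratio : ℚ → ℕ → ℕ → ℚ
ratio q n k = (1ℚ + q ^ k) * qbinom q n k * inv (qbinom q (n ℕ.+ k) k)

{-# OPTIONS --safe #-}
-- Put ratio(n,k) = (1 + q^k) [n,k]/[n+k,k] and T_n g = Σ_{k ≤ n} ratio(n,k) g(k).  With the
-- weight w(k) = q^k/[k]², the quotient of q-binomials satisfies the Pascal-type rule
--   ratio(n+1,k) w(k) = ratio(n,k) w(k) + w(n+1) ratio(n+1,k),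
-- so T_{n+1}(w f) = T_n(w f) + w(n+1) T_{n+1} f.  This is exactly the recursion in n of
-- H*_n[2, s] (and, after multiplying H*_k[s] by [k], of H*_n[1, s]); hence every leading 2
-- multiplies the kernel by w, and the three families follow by induction on a.  The base cases
-- are telescoping sums: T_n((-1)^(k-1) q^(k(k-1)/2)) = 1 and T_n([k] q^(k(k-1))) = [n], the
-- latter with partial sums [n] - q^(j²) ([n,j]/[n+j,j]) ([n] - [j]); for the last family,
-- summation by parts against these partial sums rewrites [n] · T_n(kernel of {2}^b).
module Submission where

open import Data.Empty using (⊥-elim)
open import Data.Integer as ℤ using (+_)
open import Data.Integer.Properties using (m-n≡m⊖n; ⊖-≥; ⊖-<)
open import Data.List using ([]; _∷_; _++_; replicate)
open import Data.Nat as ℕ using (ℕ; zero; suc; _≤_; z≤n; s≤s; _∸_; _≤?_)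
open import Data.Nat.DivMod using (_/_; m*n/n≡m)
open import Data.Nat.Properties as ℕₚ
  using (m≤n⇒m≤1+n; ≤-refl; m+n∸m≡n; +-suc; m+[n∸m]≡n; m≤n⇒m<n∨m≡n; ≤-pred)
open import Data.Nat.Tactic.RingSolver using () renaming (solve-∀ to ℕ-solve-∀)
open import Data.Product using (_×_; _,_)
open import Data.Rational using (ℚ; 0ℚ; 1ℚ; _<_; _+_; _*_; _-_; -_; ≢-nonZero; positive)
open import Data.Rational.Properties
  using (_≟_; +-*-commutativeRing; *-inverseʳ; *-zeroˡ; *-zeroʳ; *-identityˡ; *-identityʳ; *-assoc; *-comm; *-distribˡ-+; *-distribʳ-+; neg-distrib-+; 1≢0; <⇒≢; *-monoʳ-<-pos; <-trans)
open import Data.Sum using (inj₁; inj₂)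
open import Level using (0ℓ)
open import Relation.Binary.PropositionalEquality hiding ([_])
open import Relation.Nullary.Decidable.Core using (Dec; yes; no; dec⇒maybe)
open import Tactic.RingSolver using (solve-∀)
import Tactic.RingSolver.Core.AlmostCommutativeRing as ACR

open import Defs

open ≡-Reasoning

ℚ-ring : ACR.AlmostCommutativeRing 0ℓ 0ℓ
ℚ-ring = ACR.fromCommutativeRing +-*-commutativeRing (λ x → dec⇒maybe (0ℚ ≟ x))

inv-inverseʳ : ∀ {x} → x ≢ 0ℚ → x * inv x ≡ 1ℚ
inv-inverseʳ {x} x≢0 with x ≟ 0ℚ
... | yes x≡0 = ⊥-elim (x≢0 x≡0)
... | no  x≢0′ = *-inverseʳ x {{≢-nonZero x≢0′}}

cancel-inverse : ∀ {c} x → c ≢ 0ℚ → x * (c * inv c) ≡ x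
cancel-inverse {c} x c≢0 = trans (cong (x *_) (inv-inverseʳ c≢0)) (*-identityʳ x)

*-≢0 : ∀ {x y} → x ≢ 0ℚ → y ≢ 0ℚ → x * y ≢ 0ℚ
*-≢0 {x} {y} x≢0 y≢0 xy≡0 = 1≢0 (begin
  1ℚ                       ≡⟨ cong₂ _*_ (inv-inverseʳ x≢0) (inv-inverseʳ y≢0) ⟨
  x * inv x * (y * inv y)  ≡⟨ regroup x y (inv x) (inv y) ⟩
  x * y * (inv x * inv y)  ≡⟨ cong (_* (inv x * inv y)) xy≡0 ⟩
  0ℚ * (inv x * inv y)     ≡⟨ *-zeroˡ (inv x * inv y) ⟩
  0ℚ                       ∎)
  where
  regroup : ∀ a b c d → a * c * (b * d) ≡ a * b * (c * d)
  regroup = solve-∀ ℚ-ring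

*-cancelʳ-≡ : ∀ {a b c} → c ≢ 0ℚ → a * c ≡ b * c → a ≡ b
*-cancelʳ-≡ {a} {b} {c} c≢0 ac≡bc = begin
  a                  ≡⟨ cancel-inverse a c≢0 ⟨
  a * (c * inv c)    ≡⟨ *-assoc a c (inv c) ⟨
  a * c * inv c      ≡⟨ cong (_* inv c) ac≡bc ⟩
  b * c * inv c      ≡⟨ *-assoc b c (inv c) ⟩
  b * (c * inv c)    ≡⟨ cancel-inverse b c≢0 ⟩
  b                  ∎

inv-≢0 : ∀ {x} → x ≢ 0ℚ → inv x ≢ 0ℚ
inv-≢0 {x} x≢0 inv≡0 = 1≢0 (begin
  1ℚ         ≡⟨ inv-inverseʳ x≢0 ⟨
  x * inv x  ≡⟨ cong (x *_) inv≡0 ⟩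
  x * 0ℚ     ≡⟨ *-zeroʳ x ⟩
  0ℚ         ∎)

inv-involutive : ∀ {x} → x ≢ 0ℚ → inv (inv x) ≡ x
inv-involutive {x} x≢0 = *-cancelʳ-≡ (inv-≢0 x≢0) (begin
  inv (inv x) * inv x  ≡⟨ *-comm (inv (inv x)) (inv x) ⟩
  inv x * inv (inv x)  ≡⟨ inv-inverseʳ (inv-≢0 x≢0) ⟩
  1ℚ                   ≡⟨ inv-inverseʳ x≢0 ⟨
  x * inv x            ∎)

inv-distrib-* : ∀ x y → inv (x * y) ≡ inv x * inv y
inv-distrib-* x y = by-cases (x ≟ 0ℚ) (y ≟ 0ℚ)
  where
  regroup : ∀ a b c d → a * c * (b * d) ≡ c * d * (a * b)
  regroup = solve-∀ ℚ-ring
  by-cases : Dec (x ≡ 0ℚ) → Dec (y ≡ 0ℚ) → inv (x * y) ≡ inv x * inv y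
  by-cases (yes refl) _          = trans (cong inv (*-zeroˡ y)) (sym (*-zeroˡ (inv y)))
  by-cases (no _)     (yes refl) = trans (cong inv (*-zeroʳ x)) (sym (*-zeroʳ (inv x)))
  by-cases (no x≢0)   (no y≢0)   = *-cancelʳ-≡ (*-≢0 x≢0 y≢0) (begin
    inv (x * y) * (x * y)    ≡⟨ *-comm (inv (x * y)) (x * y) ⟩
    x * y * inv (x * y)      ≡⟨ inv-inverseʳ (*-≢0 x≢0 y≢0) ⟩
    1ℚ                       ≡⟨ cong₂ _*_ (inv-inverseʳ x≢0) (inv-inverseʳ y≢0) ⟨
    x * inv x * (y * inv y)  ≡⟨ regroup x y (inv x) (inv y) ⟩
    inv x * inv y * (x * y)  ∎)

inv-^2 : ∀ x → inv (x ^ 2) ≡ inv x * inv x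
inv-^2 x = begin
  inv (x * (x * 1ℚ))            ≡⟨ inv-distrib-* x (x * 1ℚ) ⟩
  inv x * inv (x * 1ℚ)          ≡⟨ cong (inv x *_) (inv-distrib-* x 1ℚ) ⟩
  inv x * (inv x * 1ℚ)          ≡⟨ cong (inv x *_) (*-identityʳ (inv x)) ⟩
  inv x * inv x                 ∎

^-distribˡ-+-* : ∀ x m n → x ^ (m ℕ.+ n) ≡ x ^ m * x ^ n
^-distribˡ-+-* x zero    n = sym (*-identityˡ (x ^ n))
^-distribˡ-+-* x (suc m) n = trans (cong (x *_) (^-distribˡ-+-* x m n)) (sym (*-assoc x (x ^ m) (x ^ n)))

^-≢0 : ∀ {x} n → x ≢ 0ℚ → x ^ n ≢ 0ℚ
^-≢0 zero    _   = 1≢0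
^-≢0 (suc n) x≢0 = *-≢0 x≢0 (^-≢0 n x≢0)

^ᶻ-cancel : ∀ {x} X Y → x ≢ 0ℚ → x ^ᶻ (+ X ℤ.- + Y) * x ^ Y ≡ x ^ X
^ᶻ-cancel {x} X Y x≢0 with Y ≤? X
... | yes Y≤X = begin
  x ^ᶻ (+ X ℤ.- + Y) * x ^ Y   ≡⟨ cong (λ z → x ^ᶻ z * x ^ Y) (trans (m-n≡m⊖n X Y) (⊖-≥ Y≤X)) ⟩
  x ^ (X ∸ Y) * x ^ Y          ≡⟨ ^-distribˡ-+-* x (X ∸ Y) Y ⟨
  x ^ (X ∸ Y ℕ.+ Y)            ≡⟨ cong (x ^_) (ℕₚ.m∸n+n≡m Y≤X) ⟩
  x ^ X                        ∎
... | no Y≰X = subst (λ Y → x ^ᶻ (+ X ℤ.- + Y) * x ^ Y ≡ x ^ X) X+1+d≡Y (above (Y ∸ suc X))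
  where
  X+1+d≡Y : X ℕ.+ suc (Y ∸ suc X) ≡ Y
  X+1+d≡Y = trans (+-suc X _) (m+[n∸m]≡n (ℕₚ.≰⇒> Y≰X))
  regroup : ∀ i a b → i * (a * b) ≡ a * (b * i)
  regroup = solve-∀ ℚ-ring
  above : ∀ d → x ^ᶻ (+ X ℤ.- + (X ℕ.+ suc d)) * x ^ (X ℕ.+ suc d) ≡ x ^ X
  above d = begin
    x ^ᶻ (+ X ℤ.- + (X ℕ.+ suc d)) * x ^ (X ℕ.+ suc d)
      ≡⟨ cong₂ (λ z w → x ^ᶻ z * w) X-[X+1+d]≡-[1+d] (^-distribˡ-+-* x X (suc d)) ⟩
    inv (x ^ suc d) * (x ^ X * x ^ suc d)    ≡⟨ regroup (inv (x ^ suc d)) (x ^ X) (x ^ suc d) ⟩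
    x ^ X * (x ^ suc d * inv (x ^ suc d))    ≡⟨ cancel-inverse (x ^ X) (^-≢0 (suc d) x≢0) ⟩
    x ^ X                                     ∎
    where
    X-[X+1+d]≡-[1+d] : + X ℤ.- + (X ℕ.+ suc d) ≡ ℤ.- (+ suc d)
    X-[X+1+d]≡-[1+d] = trans (m-n≡m⊖n X (X ℕ.+ suc d))
                         (trans (⊖-< (ℕₚ.m<m+n X (s≤s z≤n))) (cong (λ z → ℤ.- (+ z)) (m+n∸m≡n X (suc d))))

Σ-cong : ∀ n {f g : ℕ → ℚ} → (∀ k → 1 ≤ k → k ≤ n → f k ≡ g k) → Σ[1‥ n ] f ≡ Σ[1‥ n ] g
Σ-cong zero    f≗g = refl
Σ-cong (suc n) f≗g =
  cong₂ _+_ (Σ-cong n (λ k 1≤k k≤n → f≗g k 1≤k (m≤n⇒m≤1+n k≤n))) (f≗g (suc n) (s≤s z≤n) ≤-refl)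

Σ-distrib-+ : ∀ n (f g : ℕ → ℚ) → Σ[1‥ n ] (λ k → f k + g k) ≡ Σ[1‥ n ] f + Σ[1‥ n ] g
Σ-distrib-+ zero    f g = refl
Σ-distrib-+ (suc n) f g =
  trans (cong (_+ (f (suc n) + g (suc n))) (Σ-distrib-+ n f g)) (interchange (Σ[1‥ n ] f) (Σ[1‥ n ] g) (f (suc n)) (g (suc n)))
  where
  interchange : ∀ a b c d → a + b + (c + d) ≡ a + c + (b + d)
  interchange = solve-∀ ℚ-ring

*-distribˡ-Σ : ∀ n c (f : ℕ → ℚ) → c * Σ[1‥ n ] f ≡ Σ[1‥ n ] (λ k → c * f k)
*-distribˡ-Σ zero    c f = *-zeroʳ c
*-distribˡ-Σ (suc n) c f =
  trans (*-distribˡ-+ c (Σ[1‥ n ] f) (f (suc n))) (cong (_+ c * f (suc n)) (*-distribˡ-Σ n c f))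

neg-distrib-Σ : ∀ n (f : ℕ → ℚ) → - Σ[1‥ n ] f ≡ Σ[1‥ n ] (λ k → - f k)
neg-distrib-Σ zero    f = refl
neg-distrib-Σ (suc n) f = trans (neg-distrib-+ (Σ[1‥ n ] f) (f (suc n))) (cong (_+ - f (suc n)) (neg-distrib-Σ n f))

Σ-distrib-- : ∀ n (f g : ℕ → ℚ) → Σ[1‥ n ] (λ k → f k - g k) ≡ Σ[1‥ n ] f - Σ[1‥ n ] g
Σ-distrib-- n f g = trans (Σ-distrib-+ n f (λ k → - g k)) (cong (λ t → Σ[1‥ n ] f + t) (sym (neg-distrib-Σ n g)))

Σ-interchange : ∀ n (β s : ℕ → ℚ) →
  Σ[1‥ n ] (λ k → β k * Σ[1‥ k ∸ 1 ] s) ≡ Σ[1‥ n ] (λ j → s j * (Σ[1‥ n ] β - Σ[1‥ j ] β))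
Σ-interchange zero    β s = refl
Σ-interchange (suc n) β s = begin
  Σ[1‥ n ] (λ k → β k * Σ[1‥ k ∸ 1 ] s) + β (suc n) * Σ[1‥ n ] s
    ≡⟨ cong₂ _+_ (Σ-interchange n β s) (*-distribˡ-Σ n (β (suc n)) s) ⟩
  Σ[1‥ n ] (λ j → s j * (B n - B j)) + Σ[1‥ n ] (λ j → β (suc n) * s j)
    ≡⟨ Σ-distrib-+ n _ _ ⟨
  Σ[1‥ n ] (λ j → s j * (B n - B j) + β (suc n) * s j)
    ≡⟨ Σ-cong n (λ j _ _ → extend (s j) (B n) (B j) (β (suc n))) ⟩
  Σ[1‥ n ] (λ j → s j * (B (suc n) - B j))
    ≡⟨ add-vanishing _ (s (suc n)) (B (suc n)) ⟩
  Σ[1‥ n ] (λ j → s j * (B (suc n) - B j)) + s (suc n) * (B (suc n) - B (suc n)) ∎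
  where
  B : ℕ → ℚ
  B m = Σ[1‥ m ] β
  extend : ∀ a x y b → a * (x - y) + b * a ≡ a * (x + b - y)
  extend = solve-∀ ℚ-ring
  add-vanishing : ∀ z a x → z ≡ z + a * (x - x)
  add-vanishing = solve-∀ ℚ-ring

triangle : ℕ → ℕ
triangle zero    = 0
triangle (suc j) = triangle j ℕ.+ suc j

triangle*2 : ∀ j → triangle j ℕ.* 2 ≡ j ℕ.+ j ℕ.* j
triangle*2 zero    = refl
triangle*2 (suc j) = begin
  (triangle j ℕ.+ suc j) ℕ.* 2     ≡⟨ distrib (triangle j) j ⟩
  triangle j ℕ.* 2 ℕ.+ 2 ℕ.* suc j ≡⟨ cong (ℕ._+ 2 ℕ.* suc j) (triangle*2 j) ⟩
  j ℕ.+ j ℕ.* j ℕ.+ 2 ℕ.* suc j   ≡⟨ square-suc j ⟩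
  suc j ℕ.+ suc j ℕ.* suc j       ∎
  where
  distrib : ∀ t j → (t ℕ.+ suc j) ℕ.* 2 ≡ t ℕ.* 2 ℕ.+ 2 ℕ.* suc j
  distrib = ℕ-solve-∀
  square-suc : ∀ j → j ℕ.+ j ℕ.* j ℕ.+ 2 ℕ.* suc j ≡ suc j ℕ.+ suc j ℕ.* suc j
  square-suc = ℕ-solve-∀

[1+j]*j/2≡triangle : ∀ j → (suc j ℕ.* j) / 2 ≡ triangle j
[1+j]*j/2≡triangle j = trans (cong (_/ 2) (trans (expand j) (sym (triangle*2 j)))) (m*n/n≡m (triangle j) 2)
  where
  expand : ∀ j → suc j ℕ.* j ≡ j ℕ.+ j ℕ.* j
  expand = ℕ-solve-∀

j*[j+1]/2≡triangle : ∀ j → (j ℕ.* (j ℕ.+ 1)) / 2 ≡ triangle j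
j*[j+1]/2≡triangle j = trans (cong (_/ 2) (trans (expand j) (sym (triangle*2 j)))) (m*n/n≡m (triangle j) 2)
  where
  expand : ∀ j → j ℕ.* (j ℕ.+ 1) ≡ j ℕ.+ j ℕ.* j
  expand = ℕ-solve-∀

square≡triangle+triangle : ∀ j → suc j ℕ.* suc j ≡ triangle (suc j) ℕ.+ triangle j
square≡triangle+triangle j = ℕₚ.*-cancelʳ-≡ _ _ 2 (begin
  suc j ℕ.* suc j ℕ.* 2                               ≡⟨ expand j ⟩
  (j ℕ.+ j ℕ.* j) ℕ.+ (suc j ℕ.+ suc j ℕ.* suc j)     ≡⟨ cong₂ ℕ._+_ (triangle*2 j) (triangle*2 (suc j)) ⟨
  triangle j ℕ.* 2 ℕ.+ triangle (suc j) ℕ.* 2         ≡⟨ collect (triangle j) (triangle (suc j)) ⟩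
  (triangle (suc j) ℕ.+ triangle j) ℕ.* 2             ∎)
  where
  expand : ∀ j → suc j ℕ.* suc j ℕ.* 2 ≡ (j ℕ.+ j ℕ.* j) ℕ.+ (suc j ℕ.+ suc j ℕ.* suc j)
  expand = ℕ-solve-∀
  collect : ∀ a b → a ℕ.* 2 ℕ.+ b ℕ.* 2 ≡ (b ℕ.+ a) ℕ.* 2
  collect = ℕ-solve-∀

recurrence-algebra : ∀ E E′ wk wx y z W →
  E′ * ((1ℚ - z) * (1ℚ - y * z * y)) ≡ E * ((1ℚ - y * z) * (1ℚ - y * z)) →
  wk * ((1ℚ - y) * (1ℚ - y)) ≡ y * W →
  wx * ((1ℚ - y * z) * (1ℚ - y * z)) ≡ y * z * W →
  E′ * wk * ((1ℚ - y * z) * (1ℚ - y * z) * ((1ℚ - y) * (1ℚ - y)))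
    ≡ (E * wk + wx * E′) * ((1ℚ - y * z) * (1ℚ - y * z) * ((1ℚ - y) * (1ℚ - y)))
recurrence-algebra E E′ wk wx y z W E′cd≡Eaa wkee≡yW wxaa≡yzW = begin
  E′ * wk * (a * a * (e * e))                      ≡⟨ regroup₁ E′ wk a e ⟩
  wk * (e * e) * (E′ * (a * a))                    ≡⟨ cong (_* (E′ * (a * a))) wkee≡yW ⟩
  y * W * (E′ * (a * a))                           ≡⟨ key E′ y z W ⟩
  E′ * (c * d) * (y * W) + y * z * W * (E′ * (e * e))
    ≡⟨ cong₂ (λ u v → u * (y * W) + v * (E′ * (e * e))) E′cd≡Eaa (sym wxaa≡yzW) ⟩
  E * (a * a) * (y * W) + wx * (a * a) * (E′ * (e * e))
    ≡⟨ cong (λ u → E * (a * a) * u + wx * (a * a) * (E′ * (e * e))) (sym wkee≡yW) ⟩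
  E * (a * a) * (wk * (e * e)) + wx * (a * a) * (E′ * (e * e))
    ≡⟨ regroup₂ E E′ wk wx a e ⟩
  (E * wk + wx * E′) * (a * a * (e * e))           ∎
  where
  a = 1ℚ - y * z
  c = 1ℚ - z
  d = 1ℚ - y * z * y
  e = 1ℚ - y
  regroup₁ : ∀ E′ wk a e → E′ * wk * (a * a * (e * e)) ≡ wk * (e * e) * (E′ * (a * a))
  regroup₁ = solve-∀ ℚ-ring
  -- (1 - yz)² = (1 - z)(1 - y²z) + z(1 - y)²
  key : ∀ E′ y z W → y * W * (E′ * ((1ℚ - y * z) * (1ℚ - y * z)))
      ≡ E′ * ((1ℚ - z) * (1ℚ - y * z * y)) * (y * W) + y * z * W * (E′ * ((1ℚ - y) * (1ℚ - y)))
  key = solve-∀ ℚ-ring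
  regroup₂ : ∀ E E′ wk wx a e → E * (a * a) * (wk * (e * e)) + wx * (a * a) * (E′ * (e * e))
      ≡ (E * wk + wx * E′) * (a * a * (e * e))
  regroup₂ = solve-∀ ℚ-ring

module QCalculus (q : ℚ) where

  P : ℕ → ℚ
  P = poch q

  weight : ℕ → ℚ
  weight k = q ^ k * inv (([ k ] q) ^ 2)

  -- [n,j]/[n+j,j] when j + m = n; m = n - j is passed explicitly to avoid truncated subtraction.
  binomQuot : ℕ → ℕ → ℕ → ℚ
  binomQuot n j m = P n * P n * inv (P m) * inv (P (n ℕ.+ j))

  ratioSum : ℕ → (ℕ → ℚ) → ℚ
  ratioSum n g = Σ[1‥ n ] (λ k → ratio q n k * g k)

  kernel₂ : ℕ → ℕ → ℚ
  kernel₂ a k = inv (([ k ] q) ^ (2 ℕ.* a)) * sgn (k ∸ 1) * q ^ ((k ℕ.* (k ∸ 1)) / 2 ℕ.+ a ℕ.* k)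

  kernel₂₁ : ℕ → ℕ → ℚ
  kernel₂₁ a k = inv (([ k ] q) ^ (2 ℕ.* a ℕ.+ 1)) * q ^ (k ℕ.* k ℕ.+ a ℕ.* k)

  tailTerm : ℕ → ℕ → ℚ
  tailTerm b j = sgn j * (1ℚ + q ^ j) * q ^ᶻ (+ (b ℕ.* j) ℤ.- + ((j ℕ.* (j ℕ.+ 1)) / 2)) * inv (([ j ] q) ^ (2 ℕ.* b))

  kernel₂₁₂ : ℕ → ℕ → ℕ → ℚ
  kernel₂₁₂ b a k = - (inv (([ k ] q) ^ (2 ℕ.* (a ℕ.+ b) ℕ.+ 1)) * sgn k * q ^ ((k ℕ.* (k ℕ.+ 1)) / 2 ℕ.+ (a ℕ.+ b) ℕ.* k))
                    - kernel₂₁ a k * Σ[1‥ k ∸ 1 ] (tailTerm b)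

  bracketKernel : ℕ → ℚ
  bracketKernel k = [ k ] q * q ^ (k ℕ.* (k ∸ 1))

  ^-split : ∀ j m {n} → j ℕ.+ m ≡ n → q ^ n ≡ q ^ j * q ^ m
  ^-split j m refl = ^-distribˡ-+-* q j m

  qbinom-≤ : ∀ {n j m} → j ℕ.+ m ≡ n → qbinom q n j ≡ P n * inv (P j * P m)
  qbinom-≤ {n} {j} {m} j+m≡n with j ≤? n
  ... | yes _   = cong (λ i → P n * inv (P j * P i)) (trans (cong (_∸ j) (sym j+m≡n)) (m+n∸m≡n j m))
  ... | no j≰n = ⊥-elim (j≰n (subst (j ≤_) j+m≡n (ℕₚ.m≤m+n j m)))

  qbinom-> : ∀ n → qbinom q n (suc n) ≡ 0ℚ
  qbinom-> n with suc n ≤? n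
  ... | yes 1+n≤n = ⊥-elim (ℕₚ.<-irrefl refl 1+n≤n)
  ... | no _      = refl

  ratio-> : ∀ n → ratio q n (suc n) ≡ 0ℚ
  ratio-> n = trans (cong (λ b → (1ℚ + q ^ suc n) * b * inv (qbinom q (n ℕ.+ suc n) (suc n))) (qbinom-> n))
                    (vanish (1ℚ + q ^ suc n) _)
    where
    vanish : ∀ a b → a * 0ℚ * b ≡ 0ℚ
    vanish = solve-∀ ℚ-ring

  binomQuot-peelᵐ : ∀ n j m → 1ℚ - q ^ suc m ≢ 0ℚ →
    binomQuot n j (suc m) * (1ℚ - q ^ suc m) ≡ binomQuot n j m
  binomQuot-peelᵐ n j m c≢0 = begin
    P n * P n * inv (P m * c) * inv (P (n ℕ.+ j)) * c
      ≡⟨ cong (λ u → P n * P n * u * inv (P (n ℕ.+ j)) * c) (inv-distrib-* (P m) c) ⟩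
    P n * P n * (inv (P m) * inv c) * inv (P (n ℕ.+ j)) * c
      ≡⟨ regroup (P n) (inv (P m)) (inv (P (n ℕ.+ j))) c (inv c) ⟩
    binomQuot n j m * (c * inv c)
      ≡⟨ cancel-inverse (binomQuot n j m) c≢0 ⟩
    binomQuot n j m ∎
    where
    c = 1ℚ - q ^ suc m
    regroup : ∀ p ipm ipnj c ic → p * p * (ipm * ic) * ipnj * c ≡ p * p * ipm * ipnj * (c * ic)
    regroup = solve-∀ ℚ-ring

  binomQuot-peelʲ : ∀ n j m → 1ℚ - q ^ suc (n ℕ.+ j) ≢ 0ℚ →
    binomQuot n (suc j) m * (1ℚ - q ^ suc (n ℕ.+ j)) ≡ binomQuot n j m
  binomQuot-peelʲ n j m d≢0 = begin
    P n * P n * inv (P m) * inv (P (n ℕ.+ suc j)) * d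
      ≡⟨ cong (λ i → P n * P n * inv (P m) * inv (P i) * d) (+-suc n j) ⟩
    P n * P n * inv (P m) * inv (P (n ℕ.+ j) * d) * d
      ≡⟨ cong (λ u → P n * P n * inv (P m) * u * d) (inv-distrib-* (P (n ℕ.+ j)) d) ⟩
    P n * P n * inv (P m) * (inv (P (n ℕ.+ j)) * inv d) * d
      ≡⟨ regroup (P n) (inv (P m)) (inv (P (n ℕ.+ j))) d (inv d) ⟩
    binomQuot n j m * (d * inv d)
      ≡⟨ cancel-inverse (binomQuot n j m) d≢0 ⟩
    binomQuot n j m ∎
    where
    d = 1ℚ - q ^ suc (n ℕ.+ j)
    regroup : ∀ p ipm ipnj d id → p * p * ipm * (ipnj * id) * d ≡ p * p * ipm * ipnj * (d * id)
    regroup = solve-∀ ℚ-ring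

  binomQuot-suc : ∀ n k m → 1ℚ - q ^ suc m ≢ 0ℚ → 1ℚ - q ^ suc (n ℕ.+ k) ≢ 0ℚ →
    binomQuot (suc n) k (suc m) * ((1ℚ - q ^ suc m) * (1ℚ - q ^ suc (n ℕ.+ k)))
      ≡ binomQuot n k m * ((1ℚ - q ^ suc n) * (1ℚ - q ^ suc n))
  binomQuot-suc n k m c≢0 d≢0 = begin
    P n * a * (P n * a) * inv (P m * c) * inv (P (n ℕ.+ k) * d) * (c * d)
      ≡⟨ cong₂ (λ u v → P n * a * (P n * a) * u * v * (c * d))
               (inv-distrib-* (P m) c) (inv-distrib-* (P (n ℕ.+ k)) d) ⟩
    P n * a * (P n * a) * (inv (P m) * inv c) * (inv (P (n ℕ.+ k)) * inv d) * (c * d)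
      ≡⟨ regroup (P n) a (inv (P m)) (inv (P (n ℕ.+ k))) c (inv c) d (inv d) ⟩
    binomQuot n k m * (a * a) * (c * inv c) * (d * inv d)
      ≡⟨ cong (_* (d * inv d)) (cancel-inverse (binomQuot n k m * (a * a)) c≢0) ⟩
    binomQuot n k m * (a * a) * (d * inv d)
      ≡⟨ cancel-inverse (binomQuot n k m * (a * a)) d≢0 ⟩
    binomQuot n k m * (a * a) ∎
    where
    a = 1ℚ - q ^ suc n
    c = 1ℚ - q ^ suc m
    d = 1ℚ - q ^ suc (n ℕ.+ k)
    regroup : ∀ p a ipm ipnk c ic d id →
      p * a * (p * a) * (ipm * ic) * (ipnk * id) * (c * d) ≡ p * p * ipm * ipnk * (a * a) * (c * ic) * (d * id)
    regroup = solve-∀ ℚ-ring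

  ratio≡binomQuot : ∀ n j m → P j ≢ 0ℚ → P n ≢ 0ℚ → j ℕ.+ m ≡ n → ratio q n j ≡ (1ℚ + q ^ j) * binomQuot n j m
  ratio≡binomQuot n j m Pj≢0 Pn≢0 j+m≡n = begin
    (1ℚ + q ^ j) * qbinom q n j * inv (qbinom q (n ℕ.+ j) j)
      ≡⟨ cong₂ (λ u v → (1ℚ + q ^ j) * u * inv v) (qbinom-≤ {n} {j} j+m≡n) (qbinom-≤ {n ℕ.+ j} {j} (ℕₚ.+-comm j n)) ⟩
    (1ℚ + q ^ j) * (P n * inv (P j * P m)) * inv (P (n ℕ.+ j) * inv (P j * P n))
      ≡⟨ cong₂ (λ u v → (1ℚ + q ^ j) * (P n * u) * v) (inv-distrib-* (P j) (P m)) (begin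
           inv (P (n ℕ.+ j) * inv (P j * P n))        ≡⟨ inv-distrib-* (P (n ℕ.+ j)) _ ⟩
           inv (P (n ℕ.+ j)) * inv (inv (P j * P n))  ≡⟨ cong (inv (P (n ℕ.+ j)) *_) (inv-involutive (*-≢0 Pj≢0 Pn≢0)) ⟩
           inv (P (n ℕ.+ j)) * (P j * P n)            ∎) ⟩
    (1ℚ + q ^ j) * (P n * (inv (P j) * inv (P m))) * (inv (P (n ℕ.+ j)) * (P j * P n))
      ≡⟨ regroup (1ℚ + q ^ j) (P n) (P j) (inv (P j)) (inv (P m)) (inv (P (n ℕ.+ j))) ⟩
    (1ℚ + q ^ j) * binomQuot n j m * (P j * inv (P j))
      ≡⟨ cancel-inverse ((1ℚ + q ^ j) * binomQuot n j m) Pj≢0 ⟩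
    (1ℚ + q ^ j) * binomQuot n j m ∎
    where
    regroup : ∀ s pn pj ipj ipm ipnj → s * (pn * (ipj * ipm)) * (ipnj * (pj * pn)) ≡ s * (pn * pn * ipm * ipnj) * (pj * ipj)
    regroup = solve-∀ ℚ-ring

  binomQuot-diag : ∀ n → P n ≢ 0ℚ → binomQuot n 0 n ≡ 1ℚ
  binomQuot-diag n Pn≢0 = begin
    P n * P n * inv (P n) * inv (P (n ℕ.+ 0))  ≡⟨ cong (λ i → P n * P n * inv (P n) * inv (P i)) (ℕₚ.+-identityʳ n) ⟩
    P n * P n * inv (P n) * inv (P n)          ≡⟨ regroup (P n) (inv (P n)) ⟩
    P n * inv (P n) * (P n * inv (P n))        ≡⟨ cong₂ _*_ (inv-inverseʳ Pn≢0) (inv-inverseʳ Pn≢0) ⟩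
    1ℚ                                          ∎
    where
    regroup : ∀ p ip → p * p * ip * ip ≡ p * ip * (p * ip)
    regroup = solve-∀ ℚ-ring

  weight-shift : ∀ k e E {e′ E′} (s : ℚ) → 2 ℕ.+ e ≡ e′ → k ℕ.+ E ≡ E′ →
    weight k * (inv (([ k ] q) ^ e) * s * q ^ E) ≡ inv (([ k ] q) ^ e′) * s * q ^ E′
  weight-shift k e E s refl refl = begin
    q ^ k * inv (b ^ 2) * (inv (b ^ e) * s * q ^ E)    ≡⟨ regroup (q ^ k) (inv (b ^ 2)) (inv (b ^ e)) s (q ^ E) ⟩
    inv (b ^ 2) * inv (b ^ e) * s * (q ^ k * q ^ E)    ≡⟨ cong₂ (λ u v → u * s * v) (inv-distrib-* (b ^ 2) (b ^ e)) (^-distribˡ-+-* q k E) ⟨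
    inv (b ^ 2 * b ^ e) * s * q ^ (k ℕ.+ E)            ≡⟨ cong (λ u → inv u * s * q ^ (k ℕ.+ E)) (^-distribˡ-+-* b 2 e) ⟨
    inv (b ^ (2 ℕ.+ e)) * s * q ^ (k ℕ.+ E)            ∎
    where
    b = [ k ] q
    regroup : ∀ x ib2 ibe s y → x * ib2 * (ibe * s * y) ≡ ib2 * ibe * s * (x * y)
    regroup = solve-∀ ℚ-ring

  kernel₂-suc : ∀ a k → kernel₂ (suc a) k ≡ weight k * kernel₂ a k
  kernel₂-suc a k = sym (weight-shift k (2 ℕ.* a) _ (sgn (k ∸ 1)) (2+2a a) (shift ((k ℕ.* (k ∸ 1)) / 2) a k))
    where
    2+2a : ∀ a → 2 ℕ.+ 2 ℕ.* a ≡ 2 ℕ.* suc a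
    2+2a = ℕ-solve-∀
    shift : ∀ t a k → k ℕ.+ (t ℕ.+ a ℕ.* k) ≡ t ℕ.+ suc a ℕ.* k
    shift = ℕ-solve-∀

  kernel₂₁-suc : ∀ a k → kernel₂₁ (suc a) k ≡ weight k * kernel₂₁ a k
  kernel₂₁-suc a k = begin
    inv (b ^ (2 ℕ.* suc a ℕ.+ 1)) * q ^ (k ℕ.* k ℕ.+ suc a ℕ.* k)
      ≡⟨ cong (_* q ^ (k ℕ.* k ℕ.+ suc a ℕ.* k)) (*-identityʳ (inv (b ^ (2 ℕ.* suc a ℕ.+ 1)))) ⟨
    inv (b ^ (2 ℕ.* suc a ℕ.+ 1)) * 1ℚ * q ^ (k ℕ.* k ℕ.+ suc a ℕ.* k)
      ≡⟨ weight-shift k (2 ℕ.* a ℕ.+ 1) (k ℕ.* k ℕ.+ a ℕ.* k) 1ℚ (2+[2a+1] a) (shift (k ℕ.* k) a k) ⟨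
    weight k * (inv (b ^ (2 ℕ.* a ℕ.+ 1)) * 1ℚ * q ^ (k ℕ.* k ℕ.+ a ℕ.* k))
      ≡⟨ cong (λ u → weight k * (u * q ^ (k ℕ.* k ℕ.+ a ℕ.* k))) (*-identityʳ (inv (b ^ (2 ℕ.* a ℕ.+ 1)))) ⟩
    weight k * kernel₂₁ a k ∎
    where
    b = [ k ] q
    2+[2a+1] : ∀ a → 2 ℕ.+ (2 ℕ.* a ℕ.+ 1) ≡ 2 ℕ.* suc a ℕ.+ 1
    2+[2a+1] = ℕ-solve-∀
    shift : ∀ t a k → k ℕ.+ (t ℕ.+ a ℕ.* k) ≡ t ℕ.+ suc a ℕ.* k
    shift = ℕ-solve-∀

  kernel₂₁₂-suc : ∀ b a k → kernel₂₁₂ b (suc a) k ≡ weight k * kernel₂₁₂ b a k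
  kernel₂₁₂-suc b a k = begin
    - X′ - kernel₂₁ (suc a) k * S
      ≡⟨ cong₂ (λ u v → - u - v * S) (sym lead) (kernel₂₁-suc a k) ⟩
    - (weight k * X) - weight k * kernel₂₁ a k * S
      ≡⟨ distrib (weight k) X (kernel₂₁ a k) S ⟩
    weight k * (- X - kernel₂₁ a k * S) ∎
    where
    T = (k ℕ.* (k ℕ.+ 1)) / 2
    X = inv (([ k ] q) ^ (2 ℕ.* (a ℕ.+ b) ℕ.+ 1)) * sgn k * q ^ (T ℕ.+ (a ℕ.+ b) ℕ.* k)
    X′ = inv (([ k ] q) ^ (2 ℕ.* (suc a ℕ.+ b) ℕ.+ 1)) * sgn k * q ^ (T ℕ.+ (suc a ℕ.+ b) ℕ.* k)
    S = Σ[1‥ k ∸ 1 ] (tailTerm b)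
    2+[2c+1] : ∀ a b → 2 ℕ.+ (2 ℕ.* (a ℕ.+ b) ℕ.+ 1) ≡ 2 ℕ.* (suc a ℕ.+ b) ℕ.+ 1
    2+[2c+1] = ℕ-solve-∀
    shift : ∀ t a b k → k ℕ.+ (t ℕ.+ (a ℕ.+ b) ℕ.* k) ≡ t ℕ.+ (suc a ℕ.+ b) ℕ.* k
    shift = ℕ-solve-∀
    lead : weight k * X ≡ X′
    lead = weight-shift k _ _ (sgn k) (2+[2c+1] a b) (shift T a b k)
    distrib : ∀ w x y s → - (w * x) - w * y * s ≡ w * (- x - y * s)
    distrib = solve-∀ ℚ-ring

  kernel₂₀-suc : ∀ j → kernel₂ 0 (suc j) ≡ sgn j * q ^ triangle j
  kernel₂₀-suc j = trans (cong (λ e → 1ℚ * sgn j * q ^ e) (trans (ℕₚ.+-identityʳ _) ([1+j]*j/2≡triangle j))) (idˡ (sgn j) _)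
    where
    idˡ : ∀ a b → 1ℚ * a * b ≡ a * b
    idˡ = solve-∀ ℚ-ring

  bracketKernel-suc : ∀ j → bracketKernel (suc j) ≡ [ suc j ] q * (q ^ j * q ^ (j ℕ.* j))
  bracketKernel-suc j = cong ([ suc j ] q *_) (^-distribˡ-+-* q j (j ℕ.* j))

  q^[1+j]² : ∀ j → q ^ (suc j ℕ.* suc j) ≡ q ^ (j ℕ.* j) * q ^ j * q ^ suc j
  q^[1+j]² j = begin
    q ^ (suc j ℕ.* suc j)                  ≡⟨ cong (q ^_) (expand j) ⟩
    q ^ (j ℕ.* j ℕ.+ j ℕ.+ suc j)          ≡⟨ ^-distribˡ-+-* q (j ℕ.* j ℕ.+ j) (suc j) ⟩
    q ^ (j ℕ.* j ℕ.+ j) * q ^ suc j        ≡⟨ cong (_* q ^ suc j) (^-distribˡ-+-* q (j ℕ.* j) j) ⟩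
    q ^ (j ℕ.* j) * q ^ j * q ^ suc j      ∎
    where
    expand : ∀ j → suc j ℕ.* suc j ≡ j ℕ.* j ℕ.+ j ℕ.+ suc j
    expand = ℕ-solve-∀

  [j+m]-[j] : ∀ j m {n} → j ℕ.+ m ≡ n → [ n ] q - [ j ] q ≡ q ^ j * [ m ] q
  [j+m]-[j] j m refl = begin
    (1ℚ - q ^ (j ℕ.+ m)) * ι - (1ℚ - q ^ j) * ι   ≡⟨ cong (λ x → (1ℚ - x) * ι - (1ℚ - q ^ j) * ι) (^-distribˡ-+-* q j m) ⟩
    (1ℚ - q ^ j * q ^ m) * ι - (1ℚ - q ^ j) * ι   ≡⟨ factor (q ^ j) (q ^ m) ι ⟩
    q ^ j * ((1ℚ - q ^ m) * ι)                     ∎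
    where
    ι = inv (1ℚ - q)
    factor : ∀ t v ι → (1ℚ - t * v) * ι - (1ℚ - t) * ι ≡ t * ((1ℚ - v) * ι)
    factor = solve-∀ ℚ-ring

  module _ (0<q : 0ℚ < q) (q<1 : q < 1ℚ) where

    q^suc<1 : ∀ k → q ^ suc k < 1ℚ
    q^suc<1 zero    = subst (_< 1ℚ) (sym (*-identityʳ q)) q<1
    q^suc<1 (suc k) = <-trans (subst (q * q ^ suc k <_) (*-identityʳ q) (*-monoʳ-<-pos q {{positive 0<q}} (q^suc<1 k))) q<1

    q≢0 : q ≢ 0ℚ
    q≢0 = ≢-sym (<⇒≢ 0<q)

    1-q^suc≢0 : ∀ k → 1ℚ - q ^ suc k ≢ 0ℚ
    1-q^suc≢0 k 1-x≡0 = <⇒≢ (q^suc<1 k) (begin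
      q ^ suc k              ≡⟨ double-negation (q ^ suc k) ⟩
      1ℚ - (1ℚ - q ^ suc k)  ≡⟨ cong (λ t → 1ℚ - t) 1-x≡0 ⟩
      1ℚ                     ∎)
      where
      double-negation : ∀ x → x ≡ 1ℚ - (1ℚ - x)
      double-negation = solve-∀ ℚ-ring

    1-q≢0 : 1ℚ - q ≢ 0ℚ
    1-q≢0 1-q≡0 = 1-q^suc≢0 0 (trans (cong (λ t → 1ℚ - t) (*-identityʳ q)) 1-q≡0)

    [suc]≢0 : ∀ k → [ suc k ] q ≢ 0ℚ
    [suc]≢0 k = *-≢0 (1-q^suc≢0 k) (inv-≢0 1-q≢0)

    poch≢0 : ∀ n → P n ≢ 0ℚ
    poch≢0 zero    = 1≢0
    poch≢0 (suc n) = *-≢0 (poch≢0 n) (1-q^suc≢0 n)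

    binomQuot-shift : ∀ n j m →
      binomQuot n j (suc m) * (1ℚ - q ^ suc m) ≡ binomQuot n (suc j) m * (1ℚ - q ^ n * q ^ suc j)
    binomQuot-shift n j m = begin
      binomQuot n j (suc m) * (1ℚ - q ^ suc m)               ≡⟨ binomQuot-peelᵐ n j m (1-q^suc≢0 m) ⟩
      binomQuot n j m                                        ≡⟨ binomQuot-peelʲ n j m (1-q^suc≢0 (n ℕ.+ j)) ⟨
      binomQuot n (suc j) m * (1ℚ - q ^ suc (n ℕ.+ j))       ≡⟨ cong (λ x → binomQuot n (suc j) m * (1ℚ - x)) x≡ ⟩
      binomQuot n (suc j) m * (1ℚ - q ^ n * q ^ suc j)       ∎
      where
      x≡ : q ^ suc (n ℕ.+ j) ≡ q ^ n * q ^ suc j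
      x≡ = trans (cong (q ^_) (sym (+-suc n j))) (^-distribˡ-+-* q n (suc j))

    weight-[1-q^k]² : ∀ k → weight (suc k) * ((1ℚ - q ^ suc k) * (1ℚ - q ^ suc k)) ≡ q ^ suc k * ((1ℚ - q) * (1ℚ - q))
    weight-[1-q^k]² k = begin
      q ^ suc k * inv (([ suc k ] q) ^ 2) * (d * d)
        ≡⟨ cong (λ u → q ^ suc k * u * (d * d)) (inv-^2 ([ suc k ] q)) ⟩
      q ^ suc k * (inv (d * inv (1ℚ - q)) * inv (d * inv (1ℚ - q))) * (d * d)
        ≡⟨ cong (λ u → q ^ suc k * (u * u) * (d * d)) inv[k] ⟩
      q ^ suc k * (inv d * (1ℚ - q) * (inv d * (1ℚ - q))) * (d * d)
        ≡⟨ regroup (q ^ suc k) d (inv d) (1ℚ - q) ⟩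
      q ^ suc k * ((1ℚ - q) * (1ℚ - q)) * (d * inv d) * (d * inv d)
        ≡⟨ cong (_* (d * inv d)) (cancel-inverse (q ^ suc k * ((1ℚ - q) * (1ℚ - q))) (1-q^suc≢0 k)) ⟩
      q ^ suc k * ((1ℚ - q) * (1ℚ - q)) * (d * inv d)
        ≡⟨ cancel-inverse (q ^ suc k * ((1ℚ - q) * (1ℚ - q))) (1-q^suc≢0 k) ⟩
      q ^ suc k * ((1ℚ - q) * (1ℚ - q)) ∎
      where
      d = 1ℚ - q ^ suc k
      inv[k] : inv (d * inv (1ℚ - q)) ≡ inv d * (1ℚ - q)
      inv[k] = trans (inv-distrib-* d (inv (1ℚ - q))) (cong (inv d *_) (inv-involutive 1-q≢0))
      regroup : ∀ x d id w → x * (id * w * (id * w)) * (d * d) ≡ x * (w * w) * (d * id) * (d * id)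
      regroup = solve-∀ ℚ-ring

    weight-[k] : ∀ k → weight (suc k) * [ suc k ] q ≡ q ^ suc k * inv (([ suc k ] q) ^ 1)
    weight-[k] k = begin
      q ^ suc k * inv (([ suc k ] q) ^ 2) * b    ≡⟨ cong (λ u → q ^ suc k * u * b) (inv-^2 b) ⟩
      q ^ suc k * (inv b * inv b) * b          ≡⟨ regroup (q ^ suc k) b (inv b) ⟩
      q ^ suc k * inv b * (b * inv b)          ≡⟨ cancel-inverse (q ^ suc k * inv b) ([suc]≢0 k) ⟩
      q ^ suc k * inv b                        ≡⟨ cong (q ^ suc k *_) (*-identityʳ (inv b)) ⟨
      q ^ suc k * (inv b * 1ℚ)                 ≡⟨ cong (q ^ suc k *_) (inv-distrib-* b 1ℚ) ⟨
      q ^ suc k * inv (b * 1ℚ)                 ∎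
      where
      b = [ suc k ] q
      regroup : ∀ x b ib → x * (ib * ib) * b ≡ x * ib * (b * ib)
      regroup = solve-∀ ℚ-ring

    binomQuot-recurrence : ∀ {n k m} → suc k ℕ.+ m ≡ n →
      binomQuot (suc n) (suc k) (suc m) * weight (suc k)
        ≡ binomQuot n (suc k) m * weight (suc k) + weight (suc n) * binomQuot (suc n) (suc k) (suc m)
    binomQuot-recurrence {n} {k} {m} k+m≡n =
      *-cancelʳ-≡ (*-≢0 (*-≢0 1-yz≢0 1-yz≢0) (*-≢0 (1-q^suc≢0 k) (1-q^suc≢0 k)))
        (recurrence-algebra E E′ (weight (suc k)) (weight (suc n)) y z W E′-peeled (weight-[1-q^k]² k) weight-x)
      where
      y = q ^ suc k
      z = q ^ suc m
      W = (1ℚ - q) * (1ℚ - q)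
      E = binomQuot n (suc k) m
      E′ = binomQuot (suc n) (suc k) (suc m)
      x≡yz : q ^ suc n ≡ y * z
      x≡yz = ^-split (suc k) (suc m) (trans (+-suc (suc k) m) (cong suc k+m≡n))
      1-yz≢0 : 1ℚ - y * z ≢ 0ℚ
      1-yz≢0 = subst (λ t → 1ℚ - t ≢ 0ℚ) x≡yz (1-q^suc≢0 n)
      E′-peeled : E′ * ((1ℚ - z) * (1ℚ - y * z * y)) ≡ E * ((1ℚ - y * z) * (1ℚ - y * z))
      E′-peeled = begin
        E′ * ((1ℚ - z) * (1ℚ - y * z * y))
          ≡⟨ cong (λ t → E′ * ((1ℚ - z) * (1ℚ - t))) (trans (^-distribˡ-+-* q (suc n) (suc k)) (cong (_* y) x≡yz)) ⟨
        E′ * ((1ℚ - z) * (1ℚ - q ^ suc (n ℕ.+ suc k)))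
          ≡⟨ binomQuot-suc n (suc k) m (1-q^suc≢0 m) (1-q^suc≢0 (n ℕ.+ suc k)) ⟩
        E * ((1ℚ - q ^ suc n) * (1ℚ - q ^ suc n))
          ≡⟨ cong (λ t → E * ((1ℚ - t) * (1ℚ - t))) x≡yz ⟩
        E * ((1ℚ - y * z) * (1ℚ - y * z)) ∎
      weight-x : weight (suc n) * ((1ℚ - y * z) * (1ℚ - y * z)) ≡ y * z * W
      weight-x = begin
        weight (suc n) * ((1ℚ - y * z) * (1ℚ - y * z))
          ≡⟨ cong (λ t → weight (suc n) * ((1ℚ - t) * (1ℚ - t))) x≡yz ⟨
        weight (suc n) * ((1ℚ - q ^ suc n) * (1ℚ - q ^ suc n))
          ≡⟨ weight-[1-q^k]² n ⟩
        q ^ suc n * W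
          ≡⟨ cong (_* W) x≡yz ⟩
        y * z * W ∎

    ratio-suc : ∀ n k → 1 ≤ k → k ≤ suc n →
      ratio q (suc n) k * weight k ≡ ratio q n k * weight k + weight (suc n) * ratio q (suc n) k
    ratio-suc n (suc k) _ k<1+n with m≤n⇒m<n∨m≡n k<1+n
    ... | inj₂ refl = begin
      R * w                    ≡⟨ add-zero R w ⟩
      0ℚ * w + w * R           ≡⟨ cong (λ t → t * w + w * R) (ratio-> n) ⟨
      ratio q n (suc n) * w + w * R ∎
      where
      R = ratio q (suc n) (suc n)
      w = weight (suc n)
      add-zero : ∀ r w → r * w ≡ 0ℚ * w + w * r
      add-zero = solve-∀ ℚ-ring
    ... | inj₁ k<n = begin
      ratio q (suc n) (suc k) * w                ≡⟨ cong (_* w) R′≡ ⟩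
      s * E′ * w                                 ≡⟨ *-assoc s E′ w ⟩
      s * (E′ * w)                               ≡⟨ cong (s *_) (binomQuot-recurrence k+m≡n) ⟩
      s * (E * w + weight (suc n) * E′)          ≡⟨ distrib s E w (weight (suc n)) E′ ⟩
      s * E * w + weight (suc n) * (s * E′)      ≡⟨ cong₂ (λ u v → u * w + weight (suc n) * v) R≡ R′≡ ⟨
      ratio q n (suc k) * w + weight (suc n) * ratio q (suc n) (suc k) ∎
      where
      m = n ∸ suc k
      k+m≡n : suc k ℕ.+ m ≡ n
      k+m≡n = m+[n∸m]≡n (≤-pred k<n)
      s = 1ℚ + q ^ suc k
      w = weight (suc k)
      E = binomQuot n (suc k) m
      E′ = binomQuot (suc n) (suc k) (suc m)
      R≡ : ratio q n (suc k) ≡ s * E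
      R≡ = ratio≡binomQuot n (suc k) m (poch≢0 (suc k)) (poch≢0 n) k+m≡n
      R′≡ : ratio q (suc n) (suc k) ≡ s * E′
      R′≡ = ratio≡binomQuot (suc n) (suc k) (suc m) (poch≢0 (suc k)) (poch≢0 (suc n)) (trans (+-suc (suc k) m) (cong suc k+m≡n))
      distrib : ∀ s e w v e′ → s * (e * w + v * e′) ≡ s * e * w + v * (s * e′)
      distrib = solve-∀ ℚ-ring

    ratioSum-suc : ∀ n {f g : ℕ → ℚ} → (∀ k → 1 ≤ k → g k ≡ weight k * f k) →
      ratioSum (suc n) g ≡ ratioSum n g + weight (suc n) * ratioSum (suc n) f
    ratioSum-suc n {f} {g} g≡wf = begin
      ratioSum (suc n) g
        ≡⟨ Σ-cong (suc n) termwise ⟩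
      Σ[1‥ suc n ] (λ k → ratio q n k * g k + w * (ratio q (suc n) k * f k))
        ≡⟨ Σ-distrib-+ (suc n) _ _ ⟩
      ratioSum n g + ratio q n (suc n) * g (suc n) + Σ[1‥ suc n ] (λ k → w * (ratio q (suc n) k * f k))
        ≡⟨ cong₂ _+_ last-vanishes (sym (*-distribˡ-Σ (suc n) w _)) ⟩
      ratioSum n g + w * ratioSum (suc n) f ∎
      where
      w = weight (suc n)
      termwise : ∀ k → 1 ≤ k → k ≤ suc n → ratio q (suc n) k * g k ≡ ratio q n k * g k + w * (ratio q (suc n) k * f k)
      termwise k 1≤k k≤1+n = begin
        ratio q (suc n) k * g k
          ≡⟨ cong (ratio q (suc n) k *_) (g≡wf k 1≤k) ⟩
        ratio q (suc n) k * (weight k * f k)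
          ≡⟨ *-assoc (ratio q (suc n) k) (weight k) (f k) ⟨
        ratio q (suc n) k * weight k * f k
          ≡⟨ cong (_* f k) (ratio-suc n k 1≤k k≤1+n) ⟩
        (ratio q n k * weight k + w * ratio q (suc n) k) * f k
          ≡⟨ distrib (ratio q n k) (weight k) w (ratio q (suc n) k) (f k) ⟩
        ratio q n k * (weight k * f k) + w * (ratio q (suc n) k * f k)
          ≡⟨ cong (λ t → ratio q n k * t + w * (ratio q (suc n) k * f k)) (g≡wf k 1≤k) ⟨
        ratio q n k * g k + w * (ratio q (suc n) k * f k) ∎
        where
        distrib : ∀ r wk w r′ f → (r * wk + w * r′) * f ≡ r * (wk * f) + w * (r′ * f)
        distrib = solve-∀ ℚ-ring
      last-vanishes : ratioSum n g + ratio q n (suc n) * g (suc n) ≡ ratioSum n g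
      last-vanishes = trans (cong (λ t → ratioSum n g + t * g (suc n)) (ratio-> n)) (add-zero (ratioSum n g) (g (suc n)))
        where
        add-zero : ∀ a b → a + 0ℚ * b ≡ a
        add-zero = solve-∀ ℚ-ring

    Hstar-2∷ : ∀ ss {f g : ℕ → ℚ} → (∀ k → 1 ≤ k → Hstar q k ss ≡ ratioSum k f) →
      (∀ k → 1 ≤ k → g k ≡ weight k * f k) → ∀ n → Hstar q n (+ 2 ∷ ss) ≡ ratioSum n g
    Hstar-2∷ ss H≡ g≡wf zero    = refl
    Hstar-2∷ ss {f} {g} H≡ g≡wf (suc n) = begin
      Hstar q n (+ 2 ∷ ss) + weight (suc n) * Hstar q (suc n) ss
        ≡⟨ cong₂ (λ u v → u + weight (suc n) * v) (Hstar-2∷ ss H≡ g≡wf n) (H≡ (suc n) (s≤s z≤n)) ⟩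
      ratioSum n g + weight (suc n) * ratioSum (suc n) f
        ≡⟨ ratioSum-suc n g≡wf ⟨
      ratioSum (suc n) g ∎

    Hstar-1∷ : ∀ ss {f g : ℕ → ℚ} → (∀ k → 1 ≤ k → [ k ] q * Hstar q k ss ≡ ratioSum k f) →
      (∀ k → 1 ≤ k → g k ≡ weight k * f k) → ∀ n → Hstar q n (+ 1 ∷ ss) ≡ ratioSum n g
    Hstar-1∷ ss [k]H≡ g≡wf zero    = refl
    Hstar-1∷ ss {f} {g} [k]H≡ g≡wf (suc n) = begin
      Hstar q n (+ 1 ∷ ss) + q ^ suc n * inv (([ suc n ] q) ^ 1) * H
        ≡⟨ cong (λ t → Hstar q n (+ 1 ∷ ss) + t * H) (weight-[k] n) ⟨
      Hstar q n (+ 1 ∷ ss) + weight (suc n) * [ suc n ] q * H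
        ≡⟨ cong (λ t → Hstar q n (+ 1 ∷ ss) + t) (*-assoc (weight (suc n)) ([ suc n ] q) H) ⟩
      Hstar q n (+ 1 ∷ ss) + weight (suc n) * ([ suc n ] q * H)
        ≡⟨ cong₂ (λ u v → u + weight (suc n) * v) (Hstar-1∷ ss [k]H≡ g≡wf n) ([k]H≡ (suc n) (s≤s z≤n)) ⟩
      ratioSum n g + weight (suc n) * ratioSum (suc n) f
        ≡⟨ ratioSum-suc n g≡wf ⟨
      ratioSum (suc n) g ∎
      where
      H = Hstar q (suc n) ss

    kernel₂-partial : ∀ n j m → j ℕ.+ m ≡ n →
      Σ[1‥ j ] (λ k → ratio q n k * kernel₂ 0 k) * (1ℚ - q ^ n)
        ≡ (1ℚ - q ^ n) - sgn j * q ^ triangle j * (binomQuot n j m * (1ℚ - q ^ m))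
    kernel₂-partial n zero    m refl = begin
      0ℚ * (1ℚ - q ^ n)                                      ≡⟨ vanish (1ℚ - q ^ n) ⟩
      (1ℚ - q ^ n) - 1ℚ * 1ℚ * (1ℚ * (1ℚ - q ^ n))
        ≡⟨ cong (λ E → (1ℚ - q ^ n) - 1ℚ * 1ℚ * (E * (1ℚ - q ^ n))) (binomQuot-diag n (poch≢0 n)) ⟨
      (1ℚ - q ^ n) - 1ℚ * 1ℚ * (binomQuot n 0 n * (1ℚ - q ^ n)) ∎
      where
      vanish : ∀ x → 0ℚ * x ≡ x - 1ℚ * 1ℚ * (1ℚ * x)
      vanish = solve-∀ ℚ-ring
    kernel₂-partial n (suc j) m j+m≡n = begin
      (Σ[1‥ j ] f + ratio q n (suc j) * kernel₂ 0 (suc j)) * (1ℚ - q ^ n)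
        ≡⟨ *-distribʳ-+ (1ℚ - q ^ n) (Σ[1‥ j ] f) (ratio q n (suc j) * kernel₂ 0 (suc j)) ⟩
      Σ[1‥ j ] f * (1ℚ - q ^ n) + ratio q n (suc j) * kernel₂ 0 (suc j) * (1ℚ - q ^ n)
        ≡⟨ cong₂ (λ a b → a + b * (1ℚ - q ^ n))
                 (kernel₂-partial n j (suc m) (trans (+-suc j m) j+m≡n))
                 (cong₂ _*_ (ratio≡binomQuot n (suc j) m (poch≢0 (suc j)) (poch≢0 n) j+m≡n) (kernel₂₀-suc j)) ⟩
      (1ℚ - q ^ n) - s * t * (binomQuot n j (suc m) * (1ℚ - q ^ suc m)) + (1ℚ + u) * e * (s * t) * (1ℚ - q ^ n)
        ≡⟨ cong (λ a → (1ℚ - q ^ n) - s * t * a + (1ℚ + u) * e * (s * t) * (1ℚ - q ^ n)) (binomQuot-shift n j m) ⟩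
      (1ℚ - q ^ n) - s * t * (e * (1ℚ - q ^ n * u)) + (1ℚ + u) * e * (s * t) * (1ℚ - q ^ n)
        ≡⟨ cong (λ x → (1ℚ - x) - s * t * (e * (1ℚ - x * u)) + (1ℚ + u) * e * (s * t) * (1ℚ - x)) x≡uv ⟩
      (1ℚ - u * v) - s * t * (e * (1ℚ - u * v * u)) + (1ℚ + u) * e * (s * t) * (1ℚ - u * v)
        ≡⟨ telescope s t u v e ⟩
      (1ℚ - u * v) - (- s) * (t * u) * (e * (1ℚ - v))
        ≡⟨ cong₂ (λ x y → (1ℚ - x) - (- s) * y * (e * (1ℚ - v))) x≡uv (^-distribˡ-+-* q (triangle j) (suc j)) ⟨
      (1ℚ - q ^ n) - (- s) * q ^ triangle (suc j) * (e * (1ℚ - v)) ∎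
      where
      f = λ k → ratio q n k * kernel₂ 0 k
      s = sgn j
      t = q ^ triangle j
      u = q ^ suc j
      v = q ^ m
      e = binomQuot n (suc j) m
      x≡uv : q ^ n ≡ u * v
      x≡uv = ^-split (suc j) m j+m≡n
      -- -(1 - u²v) + (1 + u)(1 - uv) = u(1 - v)
      telescope : ∀ s t u v e → (1ℚ - u * v) - s * t * (e * (1ℚ - u * v * u)) + (1ℚ + u) * e * (s * t) * (1ℚ - u * v)
                                ≡ (1ℚ - u * v) - (- s) * (t * u) * (e * (1ℚ - v))
      telescope = solve-∀ ℚ-ring

    ratioSum-kernel₂₀ : ∀ n → 1 ≤ n → ratioSum n (kernel₂ 0) ≡ 1ℚ
    ratioSum-kernel₂₀ (suc n) _ = *-cancelʳ-≡ (1-q^suc≢0 n) (begin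
      ratioSum (suc n) (kernel₂ 0) * (1ℚ - q ^ suc n)
        ≡⟨ kernel₂-partial (suc n) (suc n) 0 (ℕₚ.+-identityʳ (suc n)) ⟩
      (1ℚ - q ^ suc n) - sgn (suc n) * q ^ triangle (suc n) * (binomQuot (suc n) (suc n) 0 * (1ℚ - 1ℚ))
        ≡⟨ vanish (1ℚ - q ^ suc n) (sgn (suc n) * q ^ triangle (suc n)) (binomQuot (suc n) (suc n) 0) ⟩
      1ℚ * (1ℚ - q ^ suc n) ∎)
      where
      vanish : ∀ x c E → x - c * (E * (1ℚ - 1ℚ)) ≡ 1ℚ * x
      vanish = solve-∀ ℚ-ring

    bracketKernel-partial : ∀ n j m → j ℕ.+ m ≡ n →
      Σ[1‥ j ] (λ k → ratio q n k * bracketKernel k) ≡ [ n ] q - q ^ (j ℕ.* j) * binomQuot n j m * ([ n ] q - [ j ] q)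
    bracketKernel-partial n zero    m refl = begin
      0ℚ                                                    ≡⟨ vanish ([ n ] q) (inv (1ℚ - q)) ⟩
      [ n ] q - 1ℚ * 1ℚ * ([ n ] q - (1ℚ - 1ℚ) * inv (1ℚ - q))
        ≡⟨ cong (λ E → [ n ] q - 1ℚ * E * ([ n ] q - (1ℚ - 1ℚ) * inv (1ℚ - q))) (binomQuot-diag n (poch≢0 n)) ⟨
      [ n ] q - 1ℚ * binomQuot n 0 n * ([ n ] q - [ 0 ] q) ∎
      where
      vanish : ∀ b ι → 0ℚ ≡ b - 1ℚ * 1ℚ * (b - (1ℚ - 1ℚ) * ι)
      vanish = solve-∀ ℚ-ring
    bracketKernel-partial n (suc j) m j+m≡n = begin
      Σ[1‥ j ] f + ratio q n (suc j) * bracketKernel (suc j)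
        ≡⟨ cong₂ _+_ (bracketKernel-partial n j (suc m) j+1+m≡n)
                     (cong₂ _*_ (ratio≡binomQuot n (suc j) m (poch≢0 (suc j)) (poch≢0 n) j+m≡n) (bracketKernel-suc j)) ⟩
      [ n ] q - Q * E₀ * ([ n ] q - [ j ] q) + r
        ≡⟨ cong (λ d → [ n ] q - Q * E₀ * d + r) ([j+m]-[j] j (suc m) j+1+m≡n) ⟩
      [ n ] q - Q * E₀ * (t * ((1ℚ - q * v) * ι)) + r
        ≡⟨ regroup ([ n ] q) Q E₀ t (q * v) ι r ⟩
      [ n ] q - Q * t * ι * (E₀ * (1ℚ - q * v)) + r
        ≡⟨ cong (λ a → [ n ] q - Q * t * ι * a + r) (binomQuot-shift n j m) ⟩
      [ n ] q - Q * t * ι * (e * (1ℚ - q ^ n * (q * t))) + r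
        ≡⟨ cong (λ x → [ n ] q - Q * t * ι * (e * (1ℚ - x * (q * t))) + r) (^-split j (suc m) j+1+m≡n) ⟩
      [ n ] q - Q * t * ι * (e * (1ℚ - t * (q * v) * (q * t))) + (1ℚ + q * t) * e * ((1ℚ - q * t) * ι * (t * Q))
        ≡⟨ telescope ([ n ] q) Q q t v ι e ⟩
      [ n ] q - Q * t * (q * t) * e * (q * t * ((1ℚ - v) * ι))
        ≡⟨ cong₂ (λ x d → [ n ] q - x * e * d) (q^[1+j]² j) ([j+m]-[j] (suc j) m j+m≡n) ⟨
      [ n ] q - q ^ (suc j ℕ.* suc j) * e * ([ n ] q - [ suc j ] q) ∎
      where
      f = λ k → ratio q n k * bracketKernel k
      ι = inv (1ℚ - q)
      Q = q ^ (j ℕ.* j)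
      t = q ^ j
      v = q ^ m
      e = binomQuot n (suc j) m
      E₀ = binomQuot n j (suc m)
      r = (1ℚ + q * t) * e * ((1ℚ - q * t) * ι * (t * Q))
      j+1+m≡n : j ℕ.+ suc m ≡ n
      j+1+m≡n = trans (+-suc j m) j+m≡n
      regroup : ∀ b Q E t z ι r → b - Q * E * (t * ((1ℚ - z) * ι)) + r ≡ b - Q * t * ι * (E * (1ℚ - z)) + r
      regroup = solve-∀ ℚ-ring
      -- (1 + qt)(1 - qt) - (1 - q²t²v) = q²t²(v - 1)
      telescope : ∀ b Q q t v ι e →
        b - Q * t * ι * (e * (1ℚ - t * (q * v) * (q * t))) + (1ℚ + q * t) * e * ((1ℚ - q * t) * ι * (t * Q))
          ≡ b - Q * t * (q * t) * e * (q * t * ((1ℚ - v) * ι))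
      telescope = solve-∀ ℚ-ring

    ratioSum-bracketKernel : ∀ n → ratioSum n bracketKernel ≡ [ n ] q
    ratioSum-bracketKernel n = trans (bracketKernel-partial n n 0 (ℕₚ.+-identityʳ n)) (vanish ([ n ] q) (q ^ (n ℕ.* n) * binomQuot n n 0))
      where
      vanish : ∀ b c → b - c * (b - b) ≡ b
      vanish = solve-∀ ℚ-ring

    weight-bracketKernel : ∀ k → 1 ≤ k → weight k * bracketKernel k ≡ kernel₂₁ 0 k
    weight-bracketKernel (suc k) _ = begin
      weight (suc k) * ([ suc k ] q * q ^ E)     ≡⟨ *-assoc (weight (suc k)) ([ suc k ] q) (q ^ E) ⟨
      weight (suc k) * [ suc k ] q * q ^ E       ≡⟨ cong (_* q ^ E) (weight-[k] k) ⟩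
      q ^ suc k * inv (([ suc k ] q) ^ 1) * q ^ E ≡⟨ comm (q ^ suc k) (inv (([ suc k ] q) ^ 1)) (q ^ E) ⟩
      inv (([ suc k ] q) ^ 1) * (q ^ suc k * q ^ E) ≡⟨ cong (inv (([ suc k ] q) ^ 1) *_) (^-distribˡ-+-* q (suc k) E) ⟨
      inv (([ suc k ] q) ^ 1) * q ^ (suc k ℕ.+ E) ≡⟨ cong (λ x → inv (([ suc k ] q) ^ 1) * q ^ x) (square k) ⟩
      kernel₂₁ 0 (suc k)                          ∎
      where
      E = suc k ℕ.* k
      comm : ∀ a b c → a * b * c ≡ b * (a * c)
      comm = solve-∀ ℚ-ring
      square : ∀ k → suc k ℕ.+ suc k ℕ.* k ≡ suc k ℕ.* suc k ℕ.+ 0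
      square = ℕ-solve-∀

    Hstar-2ᵃ : ∀ a n → 1 ≤ n → Hstar q n (replicate a (+ 2)) ≡ ratioSum n (kernel₂ a)
    Hstar-2ᵃ zero    n 1≤n = sym (ratioSum-kernel₂₀ n 1≤n)
    Hstar-2ᵃ (suc a) n _   = Hstar-2∷ (replicate a (+ 2)) (Hstar-2ᵃ a) (λ k _ → kernel₂-suc a k) n

    Hstar-2ᵃ-1 : ∀ a n → Hstar q n (replicate a (+ 2) ++ (+ 1 ∷ [])) ≡ ratioSum n (kernel₂₁ a)
    Hstar-2ᵃ-1 zero    = Hstar-1∷ [] (λ k _ → trans (*-identityʳ ([ k ] q)) (sym (ratioSum-bracketKernel k))) (λ k 1≤k → sym (weight-bracketKernel k 1≤k))
    Hstar-2ᵃ-1 (suc a) = Hstar-2∷ (replicate a (+ 2) ++ (+ 1 ∷ [])) (λ k _ → Hstar-2ᵃ-1 a k) (λ k _ → kernel₂₁-suc a k)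

    kernel₂-tail : ∀ b j → 1 ≤ j → (1ℚ + q ^ j) * kernel₂ b j ≡ - (tailTerm b j * q ^ (j ℕ.* j))
    kernel₂-tail b (suc j) _ = begin
      (1ℚ + x) * (iB * s * q ^ ((suc j ℕ.* j) / 2 ℕ.+ b ℕ.* suc j))
        ≡⟨ cong (λ e → (1ℚ + x) * (iB * s * q ^ e)) (cong (ℕ._+ b ℕ.* suc j) ([1+j]*j/2≡triangle j)) ⟩
      (1ℚ + x) * (iB * s * q ^ (triangle j ℕ.+ b ℕ.* suc j))
        ≡⟨ cong (λ w → (1ℚ + x) * (iB * s * w)) (^-distribˡ-+-* q (triangle j) (b ℕ.* suc j)) ⟩
      (1ℚ + x) * (iB * s * (t * W))
        ≡⟨ cong (λ w → (1ℚ + x) * (iB * s * (t * w))) (^ᶻ-cancel (b ℕ.* suc j) T q≢0) ⟨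
      (1ℚ + x) * (iB * s * (t * (Z * q ^ T)))
        ≡⟨ regroup (1ℚ + x) iB s t Z (q ^ T) ⟩
      - ((- s) * (1ℚ + x) * Z * iB * (q ^ T * t))
        ≡⟨ cong (λ w → - ((- s) * (1ℚ + x) * Z * iB * w)) square ⟨
      - (tailTerm b (suc j) * q ^ (suc j ℕ.* suc j)) ∎
      where
      x = q ^ suc j
      s = sgn j
      t = q ^ triangle j
      W = q ^ (b ℕ.* suc j)
      T = (suc j ℕ.* (suc j ℕ.+ 1)) / 2
      Z = q ^ᶻ (+ (b ℕ.* suc j) ℤ.- + T)
      iB = inv (([ suc j ] q) ^ (2 ℕ.* b))
      square : q ^ (suc j ℕ.* suc j) ≡ q ^ T * t
      square = trans (cong (q ^_) (trans (square≡triangle+triangle j) (cong (ℕ._+ triangle j) (sym (j*[j+1]/2≡triangle (suc j))))))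
                     (^-distribˡ-+-* q T (triangle j))
      regroup : ∀ a iB s t Z y → a * (iB * s * (t * (Z * y))) ≡ - ((- s) * a * Z * iB * (y * t))
      regroup = solve-∀ ℚ-ring

    kernel₂₁₂-zero : ∀ b k → 1 ≤ k →
      kernel₂₁₂ b 0 k ≡ weight k * ([ k ] q * kernel₂ b k - bracketKernel k * Σ[1‥ k ∸ 1 ] (tailTerm b))
    kernel₂₁₂-zero b (suc j) _ = begin
      - (inv (B ^ (2 ℕ.* b ℕ.+ 1)) * (- s) * q ^ (T ℕ.+ b ℕ.* k)) - kernel₂₁ 0 k * S
        ≡⟨ cong₂ (λ u v → - (inv (B ^ u) * (- s) * q ^ v) - kernel₂₁ 0 k * S) exp-[k] exp-q ⟨
      - (inv (B ^ (1 ℕ.+ 2 ℕ.* b)) * (- s) * q ^ (k ℕ.+ E)) - kernel₂₁ 0 k * S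
        ≡⟨ cong₂ (λ u v → - (inv u * (- s) * v) - kernel₂₁ 0 k * S) (^-distribˡ-+-* B 1 (2 ℕ.* b)) (^-distribˡ-+-* q k E) ⟩
      - (inv (B ^ 1 * B ^ (2 ℕ.* b)) * (- s) * (q ^ k * q ^ E)) - kernel₂₁ 0 k * S
        ≡⟨ cong (λ u → - (u * (- s) * (q ^ k * q ^ E)) - kernel₂₁ 0 k * S) (inv-distrib-* (B ^ 1) (B ^ (2 ℕ.* b))) ⟩
      - (inv (B ^ 1) * iB * (- s) * (q ^ k * q ^ E)) - kernel₂₁ 0 k * S
        ≡⟨ regroup (inv (B ^ 1)) iB s (q ^ k) (q ^ E) (kernel₂₁ 0 k) S ⟩
      q ^ k * inv (B ^ 1) * (iB * s * q ^ E) - kernel₂₁ 0 k * S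
        ≡⟨ cong₂ (λ u v → u * kernel₂ b k - v * S) (weight-[k] j) (weight-bracketKernel k (s≤s z≤n)) ⟨
      weight k * B * kernel₂ b k - weight k * bracketKernel k * S
        ≡⟨ distrib (weight k) B (kernel₂ b k) (bracketKernel k) S ⟩
      weight k * (B * kernel₂ b k - bracketKernel k * S) ∎
      where
      k = suc j
      B = [ k ] q
      iB = inv (B ^ (2 ℕ.* b))
      s = sgn j
      S = Σ[1‥ j ] (tailTerm b)
      T = (k ℕ.* (k ℕ.+ 1)) / 2
      E = (k ℕ.* j) / 2 ℕ.+ b ℕ.* k
      exp-[k] : 1 ℕ.+ 2 ℕ.* b ≡ 2 ℕ.* b ℕ.+ 1
      exp-[k] = ℕₚ.+-comm 1 (2 ℕ.* b)
      exp-q : k ℕ.+ E ≡ T ℕ.+ b ℕ.* k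
      exp-q = begin
        k ℕ.+ ((k ℕ.* j) / 2 ℕ.+ b ℕ.* k)    ≡⟨ cong (λ t → k ℕ.+ (t ℕ.+ b ℕ.* k)) ([1+j]*j/2≡triangle j) ⟩
        k ℕ.+ (triangle j ℕ.+ b ℕ.* k)        ≡⟨ shuffle k (triangle j) (b ℕ.* k) ⟩
        triangle j ℕ.+ k ℕ.+ b ℕ.* k          ≡⟨ cong (ℕ._+ b ℕ.* k) (j*[j+1]/2≡triangle k) ⟨
        T ℕ.+ b ℕ.* k                          ∎
        where
        shuffle : ∀ k t c → k ℕ.+ (t ℕ.+ c) ≡ t ℕ.+ k ℕ.+ c
        shuffle = ℕ-solve-∀
      regroup : ∀ i₁ i₂ s x y c S → - (i₁ * i₂ * (- s) * (x * y)) - c * S ≡ x * i₁ * (i₂ * s * y) - c * S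
      regroup = solve-∀ ℚ-ring
      distrib : ∀ w b K β S → w * b * K - w * β * S ≡ w * (b * K - β * S)
      distrib = solve-∀ ℚ-ring

    ratioSum-bracketKernel-complement : ∀ n j m → j ℕ.+ m ≡ n →
      ratioSum n bracketKernel - Σ[1‥ j ] (λ k → ratio q n k * bracketKernel k) ≡ q ^ (j ℕ.* j) * binomQuot n j m * ([ n ] q - [ j ] q)
    ratioSum-bracketKernel-complement n j m j+m≡n =
      trans (cong₂ _-_ (ratioSum-bracketKernel n) (bracketKernel-partial n j m j+m≡n)) (difference ([ n ] q) _)
      where
      difference : ∀ b d → b - (b - d) ≡ d
      difference = solve-∀ ℚ-ring

    [n]*ratio*kernel₂ : ∀ b n j → 1 ≤ j → j ≤ n →
      [ n ] q * (ratio q n j * kernel₂ b j)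
        ≡ ratio q n j * ([ j ] q * kernel₂ b j)
          - tailTerm b j * (ratioSum n bracketKernel - Σ[1‥ j ] (λ k → ratio q n k * bracketKernel k))
    [n]*ratio*kernel₂ b n j 1≤j j≤n = begin
      [ n ] q * (ratio q n j * kernel₂ b j)
        ≡⟨ cong (λ r → [ n ] q * (r * kernel₂ b j)) R≡ ⟩
      [ n ] q * (c * E * kernel₂ b j)
        ≡⟨ expand ([ n ] q) ([ j ] q) c E (kernel₂ b j) ⟩
      c * E * ([ j ] q * kernel₂ b j) + E * ([ n ] q - [ j ] q) * (c * kernel₂ b j)
        ≡⟨ cong (λ t → c * E * ([ j ] q * kernel₂ b j) + E * ([ n ] q - [ j ] q) * t) (kernel₂-tail b j 1≤j) ⟩
      c * E * ([ j ] q * kernel₂ b j) + E * ([ n ] q - [ j ] q) * - (tailTerm b j * q ^ (j ℕ.* j))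
        ≡⟨ collect (c * E * ([ j ] q * kernel₂ b j)) E ([ n ] q - [ j ] q) (tailTerm b j) (q ^ (j ℕ.* j)) ⟩
      c * E * ([ j ] q * kernel₂ b j) - tailTerm b j * (q ^ (j ℕ.* j) * E * ([ n ] q - [ j ] q))
        ≡⟨ cong₂ (λ r t → r * ([ j ] q * kernel₂ b j) - tailTerm b j * t) R≡ (ratioSum-bracketKernel-complement n j m j+m≡n) ⟨
      ratio q n j * ([ j ] q * kernel₂ b j) - tailTerm b j * (ratioSum n bracketKernel - Σ[1‥ j ] (λ k → ratio q n k * bracketKernel k)) ∎
      where
      m = n ∸ j
      j+m≡n : j ℕ.+ m ≡ n
      j+m≡n = m+[n∸m]≡n j≤n
      c = 1ℚ + q ^ j
      E = binomQuot n j m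
      R≡ : ratio q n j ≡ c * E
      R≡ = ratio≡binomQuot n j m (poch≢0 j) (poch≢0 n) j+m≡n
      expand : ∀ bn bj c E K → bn * (c * E * K) ≡ c * E * (bj * K) + E * (bn - bj) * (c * K)
      expand = solve-∀ ℚ-ring
      collect : ∀ a E d τ Q → a + E * d * - (τ * Q) ≡ a - τ * (Q * E * d)
      collect = solve-∀ ℚ-ring

    [n]*ratioSum-kernel₂ : ∀ b n →
      [ n ] q * ratioSum n (kernel₂ b) ≡ ratioSum n (λ k → [ k ] q * kernel₂ b k - bracketKernel k * Σ[1‥ k ∸ 1 ] (tailTerm b))
    [n]*ratioSum-kernel₂ b n = begin
      [ n ] q * ratioSum n (kernel₂ b)
        ≡⟨ *-distribˡ-Σ n ([ n ] q) _ ⟩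
      Σ[1‥ n ] (λ j → [ n ] q * (ratio q n j * kernel₂ b j))
        ≡⟨ Σ-cong n ([n]*ratio*kernel₂ b n) ⟩
      Σ[1‥ n ] (λ j → ratio q n j * ([ j ] q * kernel₂ b j) - tailTerm b j * (Σ[1‥ n ] β - Σ[1‥ j ] β))
        ≡⟨ Σ-distrib-- n _ _ ⟩
      Σ[1‥ n ] (λ j → ratio q n j * ([ j ] q * kernel₂ b j)) - Σ[1‥ n ] (λ j → tailTerm b j * (Σ[1‥ n ] β - Σ[1‥ j ] β))
        ≡⟨ cong (λ t → Σ[1‥ n ] (λ j → ratio q n j * ([ j ] q * kernel₂ b j)) - t) (Σ-interchange n β (tailTerm b)) ⟨
      Σ[1‥ n ] (λ j → ratio q n j * ([ j ] q * kernel₂ b j)) - Σ[1‥ n ] (λ k → β k * Σ[1‥ k ∸ 1 ] (tailTerm b))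
        ≡⟨ Σ-distrib-- n _ _ ⟨
      Σ[1‥ n ] (λ k → ratio q n k * ([ k ] q * kernel₂ b k) - β k * Σ[1‥ k ∸ 1 ] (tailTerm b))
        ≡⟨ Σ-cong n (λ k _ _ → factor (ratio q n k) ([ k ] q * kernel₂ b k) (bracketKernel k) (Σ[1‥ k ∸ 1 ] (tailTerm b))) ⟩
      ratioSum n (λ k → [ k ] q * kernel₂ b k - bracketKernel k * Σ[1‥ k ∸ 1 ] (tailTerm b)) ∎
      where
      β : ℕ → ℚ
      β k = ratio q n k * bracketKernel k
      factor : ∀ r a β S → r * a - r * β * S ≡ r * (a - β * S)
      factor = solve-∀ ℚ-ring

    Hstar-2ᵃ-1-2ᵇ : ∀ b a n → Hstar q n (replicate a (+ 2) ++ (+ 1 ∷ replicate b (+ 2))) ≡ ratioSum n (kernel₂₁₂ b a)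
    Hstar-2ᵃ-1-2ᵇ b zero    = Hstar-1∷ (replicate b (+ 2))
      (λ k 1≤k → trans (cong ([ k ] q *_) (Hstar-2ᵃ b k 1≤k)) ([n]*ratioSum-kernel₂ b k))
      (kernel₂₁₂-zero b)
    Hstar-2ᵃ-1-2ᵇ b (suc a) = Hstar-2∷ (replicate a (+ 2) ++ (+ 1 ∷ replicate b (+ 2)))
      (λ k _ → Hstar-2ᵃ-1-2ᵇ b a k) (λ k _ → kernel₂₁₂-suc b a k)

theorem3p1 : (q : ℚ) → 0ℚ < q → q < 1ℚ → (a b : ℕ) → 1 ≤ b → (n : ℕ) → 1 ≤ n →
      (Hstar q n (replicate a (+ 2))
        ≡ Σ[1‥ n ] (λ k → inv (([ k ] q) ^ (2 ℕ.* a)) * ratio q n k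
                          * sgn (k ∸ 1) * q ^ ((k ℕ.* (k ∸ 1)) / 2 ℕ.+ a ℕ.* k)))
    × (Hstar q n (replicate a (+ 2) ++ (+ 1 ∷ []))
        ≡ Σ[1‥ n ] (λ k → inv (([ k ] q) ^ (2 ℕ.* a ℕ.+ 1)) * ratio q n k
                          * q ^ (k ℕ.* k ℕ.+ a ℕ.* k)))
    × (Hstar q n (replicate a (+ 2) ++ (+ 1 ∷ replicate b (+ 2)))
        ≡ (- Σ[1‥ n ] (λ k → inv (([ k ] q) ^ (2 ℕ.* (a ℕ.+ b) ℕ.+ 1)) * ratio q n k
                          * sgn k * q ^ ((k ℕ.* (k ℕ.+ 1)) / 2 ℕ.+ (a ℕ.+ b) ℕ.* k)))
          - Σ[1‥ n ] (λ k → inv (([ k ] q) ^ (2 ℕ.* a ℕ.+ 1)) * ratio q n k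
                          * q ^ (k ℕ.* k ℕ.+ a ℕ.* k)
                          * Σ[1‥ k ∸ 1 ] (λ j → sgn j * (1ℚ + q ^ j)
                              * q ^ᶻ (+ (b ℕ.* j) ℤ.- + ((j ℕ.* (j ℕ.+ 1)) / 2))
                              * inv (([ j ] q) ^ (2 ℕ.* b)))))
theorem3p1 q 0<q q<1 a b _ n 1≤n =
    trans (Hstar-2ᵃ 0<q q<1 a n 1≤n) (Σ-cong n λ k _ _ →
      move-ratio (ratio q n k) (inv (([ k ] q) ^ (2 ℕ.* a))) (sgn (k ∸ 1)) (q ^ ((k ℕ.* (k ∸ 1)) / 2 ℕ.+ a ℕ.* k)))
  , trans (Hstar-2ᵃ-1 0<q q<1 a n) (Σ-cong n λ k _ _ →
      move-ratio′ (ratio q n k) (inv (([ k ] q) ^ (2 ℕ.* a ℕ.+ 1))) (q ^ (k ℕ.* k ℕ.+ a ℕ.* k)))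
  , (begin
      Hstar q n (replicate a (+ 2) ++ (+ 1 ∷ replicate b (+ 2)))
        ≡⟨ Hstar-2ᵃ-1-2ᵇ 0<q q<1 b a n ⟩
      ratioSum n (kernel₂₁₂ b a)
        ≡⟨ Σ-cong n (λ k _ _ → distribute (ratio q n k) (inv (([ k ] q) ^ (2 ℕ.* (a ℕ.+ b) ℕ.+ 1))) (sgn k)
                                  (q ^ ((k ℕ.* (k ℕ.+ 1)) / 2 ℕ.+ (a ℕ.+ b) ℕ.* k)) (inv (([ k ] q) ^ (2 ℕ.* a ℕ.+ 1)))
                                  (q ^ (k ℕ.* k ℕ.+ a ℕ.* k)) (Σ[1‥ k ∸ 1 ] (tailTerm b))) ⟩
      Σ[1‥ n ] (λ k → - F k - G k)
        ≡⟨ Σ-distrib-- n (λ k → - F k) G ⟩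
      Σ[1‥ n ] (λ k → - F k) - Σ[1‥ n ] G
        ≡⟨ cong (_- Σ[1‥ n ] G) (neg-distrib-Σ n F) ⟨
      - Σ[1‥ n ] F - Σ[1‥ n ] G ∎)
  where
  open QCalculus q
  F G : ℕ → ℚ
  F k = inv (([ k ] q) ^ (2 ℕ.* (a ℕ.+ b) ℕ.+ 1)) * ratio q n k * sgn k * q ^ ((k ℕ.* (k ℕ.+ 1)) / 2 ℕ.+ (a ℕ.+ b) ℕ.* k)
  G k = inv (([ k ] q) ^ (2 ℕ.* a ℕ.+ 1)) * ratio q n k * q ^ (k ℕ.* k ℕ.+ a ℕ.* k) * Σ[1‥ k ∸ 1 ] (tailTerm b)
  move-ratio : ∀ r i s t → r * (i * s * t) ≡ i * r * s * t
  move-ratio = solve-∀ ℚ-ring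
  move-ratio′ : ∀ r i t → r * (i * t) ≡ i * r * t
  move-ratio′ = solve-∀ ℚ-ring
  distribute : ∀ r i s t i′ t′ S → r * (- (i * s * t) - i′ * t′ * S) ≡ - (i * r * s * t) - i′ * r * t′ * S
  distribute = solve-∀ ℚ-ring
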